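{- Let $s$ be a positive integer and let $(f_k(q))_{k\geq 0}$ be a strongly $q$-log-concave sequence of real polynomials. Then the sequence $(B_n(q))_{n\geq 0}$ defined by $B_{n}(q)=\sum_{k=0}^{sn}\binom{n}{k}_{s} f_{k}(q)$ is strongly $q$-log-concave.
   Context: For positive integers $n,s$ (and $n=0$), the bi$^s$nomial coefficients $\binom{n}{k}_s$ are defined by $(1+x+\cdots+x^{s})^{n}=\sum_{k=0}^{sn}\binom{n}{k}_{s}x^{k}$, with $\binom{n}{k}_s=0$ unless $0\leq k\leq sn$. For real polynomials $F(q),G(q)$, write $F(q)\geq_q G(q)$ if $F(q)-G(q)$ has only nonnegative coefficients. A sequence of polynomials $(F_n(q))_{n\geq 0}$ is strongly $q$-log-concave if $F_{n}(q)F_{m}(q)\geq_{q} F_{n-1}(q)F_{m+1}(q)$ for all $m\geq n\geq 1$. -}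

module Defs where

open import Level using (Level; _⊔_)
open import Data.Nat as ℕ using (ℕ; zero; suc; _≤_; _∸_)
open import Data.List using (List; []; _∷_; map; foldr; upTo; replicate)
open import Data.Sum using (_⊎_)
open import Data.Product using (_×_)
open import Algebra.Bundles using (CommutativeRing)

-- Ordered commutative rings, via a positive cone P ("nonnegative").
-- ℝ with P x := 0 ≤ x is an instance.

record OrderedCommutativeRing (c ℓ p : Level) : Set (Level.suc (c ⊔ ℓ ⊔ p)) where
  field
    commRing : CommutativeRing c ℓ
  open CommutativeRing commRing public
  field
    NonNeg       : Carrier → Set p
    NonNeg-resp  : ∀ {x y} → x ≈ y → NonNeg x → NonNeg y
    NonNeg-+     : ∀ {x y} → NonNeg x → NonNeg y → NonNeg (x + y)
    NonNeg-*     : ∀ {x y} → NonNeg x → NonNeg y → NonNeg (x * y)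
    NonNeg-total : ∀ x → NonNeg x ⊎ NonNeg (- x)
    NonNeg-antisym : ∀ {x} → NonNeg x → NonNeg (- x) → x ≈ 0#

-- Polynomials as coefficient lists (constant term first), over any
-- carrier with zero, addition and multiplication.

module PolyOps {a} {A : Set a} (z : A) (_⊕_ : A → A → A) (_⊗_ : A → A → A) where

  Poly : Set a
  Poly = List A

  addP : Poly → Poly → Poly
  addP []       q        = q
  addP (x ∷ p)  []       = x ∷ p
  addP (x ∷ p)  (y ∷ q)  = (x ⊕ y) ∷ addP p q

  scaleP : A → Poly → Poly
  scaleP c = map (c ⊗_)

  mulP : Poly → Poly → Poly
  mulP []      q = []
  mulP (x ∷ p) q = addP (scaleP x q) (z ∷ mulP p q)

  coeff : Poly → ℕ → A
  coeff []      i       = z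
  coeff (x ∷ p) zero    = x
  coeff (x ∷ p) (suc i) = coeff p i

  sumP : List Poly → Poly
  sumP = foldr addP []

-- bi^s-nomial coefficients: (1 + x + ... + x^s)^n = Σ_k binom s n k x^k

module ℕPoly = PolyOps 0 ℕ._+_ ℕ._*_

powℕ : ℕPoly.Poly → ℕ → ℕPoly.Poly
powℕ p zero    = 1 ∷ []
powℕ p (suc n) = ℕPoly.mulP p (powℕ p n)

binom : (s n k : ℕ) → ℕ
binom s n k = ℕPoly.coeff (powℕ (replicate (suc s) 1) n) k

module OverRing {c ℓ p} (R : OrderedCommutativeRing c ℓ p) where
  open OrderedCommutativeRing R
  open PolyOps 0# _+_ _*_ public

  fromℕ : ℕ → Carrier
  fromℕ zero    = 0#
  fromℕ (suc n) = 1# + fromℕ n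

  _≥q_ : Poly → Poly → Set p
  F ≥q G = ∀ i → NonNeg (coeff F i - coeff G i)

  StronglyQLogConcave : (ℕ → Poly) → Set p
  StronglyQLogConcave F =
    ∀ m n → 1 ≤ n → n ≤ m → mulP (F n) (F m) ≥q mulP (F (n ∸ 1)) (F (suc m))

  B : (s : ℕ) → (ℕ → Poly) → ℕ → Poly
  B s f n = sumP (map (λ k → scaleP (fromℕ (binom s n k)) (f k)) (upTo (suc (s ℕ.* n))))

{-# OPTIONS --safe #-}
-- Work coefficientwise: a polynomial is its coefficient sequence, products are convolutions,
-- and F ≥q G says that coeff F - coeff G lies in the cone of coefficientwise nonnegative
-- sequences.  With E the shift on sequences of polynomials, B_n is the 0-th term of
-- (1 + E + ⋯ + E^s)^n f, i.e. of W^n f for the window sum (W a)_k = a_k + ⋯ + a_(k+s).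
-- Log-concavity of a yields the cross inequalities a_k b_(l+d) ≤ a_(k+d) b_l (k ≤ l) for b = a;
-- W preserves log-concavity (telescope with (W a)_(k+1) = (W a)_k + a_(k+s+1) - a_k), and
-- cross inequalities between a and b persist between a and W b.  So they hold between W^n f
-- and W^m f for n ≤ m, and summing them over one window at k = l = 0 gives
-- B_n B_(m+1) ≤q B_(n+1) B_m.
module Submission where

open import Defs
open import Algebra.Bundles using (AbelianGroup; CommutativeMonoid; CommutativeRing)
open import Data.Fin as Fin using (toℕ)
open import Data.Fin.Properties using (toℕ<n; toℕ-inject₁; toℕ-fromℕ)
open import Data.List using (List; []; _∷_; length; replicate; map; applyUpTo; upTo)
open import Data.List.Properties using (length-map; length-replicate; map-upTo)
open import Data.Nat as ℕ using (ℕ; zero; suc; _≤_; _⊔_; z≤n; s≤s)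
open import Data.Nat.GeneralisedArithmetic using (fold; fold-+)
import Data.Nat.Properties as ℕ
open import Data.Sum using (inj₁; inj₂)
open import Data.Vec.Functional using (Vector; init)
open import Function using (_∘_)
open import Relation.Binary.Bundles using (Preorder)
import Relation.Binary.Reasoning.Preorder
open import Relation.Binary.Core using (Rel)
open import Relation.Binary.Definitions using (_Respects_)
open import Relation.Binary.PropositionalEquality as ≡ using (_≡_)
open import Relation.Binary.Structures using (IsPreorder)

module _ where
  open import Data.Nat using (_+_; _*_)
  open ℕPoly using (addP; scaleP; mulP)
  open ≡.≡-Reasoning

  length-addP : ∀ P Q → length (addP P Q) ≡ length P ⊔ length Q
  length-addP []      Q       = ≡.refl
  length-addP (x ∷ P) []      = ≡.refl
  length-addP (x ∷ P) (y ∷ Q) = ≡.cong suc (length-addP P Q)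

  length-mulP : ∀ x P Q {r} → length Q ≡ suc r → length (mulP (x ∷ P) Q) ≡ suc (length P + r)
  length-mulP x P Q {r} len-Q = begin
    length (addP (scaleP x Q) (0 ∷ mulP P Q))      ≡⟨ length-addP (scaleP x Q) (0 ∷ mulP P Q) ⟩
    length (scaleP x Q) ⊔ suc (length (mulP P Q))  ≡⟨ ≡.cong (_⊔ _) (≡.trans (length-map (x *_) Q) len-Q) ⟩
    suc r ⊔ suc (length (mulP P Q))                ≡⟨ absorb P ⟩
    suc (length P + r)                             ∎
    where
    absorb : ∀ P → suc r ⊔ suc (length (mulP P Q)) ≡ suc (length P + r)
    absorb []      = ≡.cong suc (ℕ.⊔-identityʳ r)
    absorb (y ∷ P) = begin
      suc r ⊔ suc (length (mulP (y ∷ P) Q))  ≡⟨ ≡.cong (λ n → suc r ⊔ suc n) (length-mulP y P Q len-Q) ⟩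
      suc r ⊔ suc (suc (length P + r))       ≡⟨ ℕ.m≤n⇒m⊔n≡n (s≤s (ℕ.m≤n+m r (suc (length P)))) ⟩
      suc (suc (length P + r))               ∎

  length-powℕ : ∀ s n → length (powℕ (replicate (suc s) 1) n) ≡ suc (s * n)
  length-powℕ s zero    = ≡.cong suc (≡.sym (ℕ.*-zeroʳ s))
  length-powℕ s (suc n) = begin
    length (mulP (1 ∷ replicate s 1) (powℕ (replicate (suc s) 1) n))
      ≡⟨ length-mulP 1 (replicate s 1) (powℕ (replicate (suc s) 1) n) (length-powℕ s n) ⟩
    suc (length (replicate s 1) + s * n)  ≡⟨ ≡.cong (λ m → suc (m + s * n)) (length-replicate s) ⟩
    suc (s + s * n)                       ≡⟨ ≡.cong suc (ℕ.*-suc s n) ⟨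
    suc (s * suc n)                       ∎

module PositiveCone {a ℓ p} (G : AbelianGroup a ℓ) (Pos : AbelianGroup.Carrier G → Set p)
  (Pos-resp : Pos Respects AbelianGroup._≈_ G) (Pos-ε : Pos (AbelianGroup.ε G))
  (Pos-∙ : ∀ {x y} → Pos x → Pos y → Pos (AbelianGroup._∙_ G x y)) where

  open AbelianGroup G
  open import Algebra.Properties.AbelianGroup G using (⁻¹-∙-comm; x≈y⇒x∙y⁻¹≈ε)
  open import Algebra.Properties.CommutativeSemigroup commutativeSemigroup using (interchange)
  open import Algebra.Properties.Monoid.Sum monoid using (sum)
  open import Relation.Binary.Reasoning.Setoid setoid

  infix 4 _≼_
  _≼_ : Rel Carrier p
  x ≼ y = Pos (y ∙ x ⁻¹)

  private
    ⁻¹-∙-interchange : ∀ x y u v → (y ∙ x ⁻¹) ∙ (v ∙ u ⁻¹) ≈ (y ∙ v) ∙ (x ∙ u) ⁻¹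
    ⁻¹-∙-interchange x y u v = begin
      (y ∙ x ⁻¹) ∙ (v ∙ u ⁻¹) ≈⟨ interchange y (x ⁻¹) v (u ⁻¹) ⟩
      (y ∙ v) ∙ (x ⁻¹ ∙ u ⁻¹) ≈⟨ ∙-congˡ (⁻¹-∙-comm x u) ⟩
      (y ∙ v) ∙ (x ∙ u) ⁻¹    ∎

    ∙-cancelʳ-⁻¹ : ∀ x y z → (y ∙ z) ∙ (x ∙ z) ⁻¹ ≈ y ∙ x ⁻¹
    ∙-cancelʳ-⁻¹ x y z = begin
      (y ∙ z) ∙ (x ∙ z) ⁻¹      ≈⟨ ⁻¹-∙-interchange x y z z ⟨
      (y ∙ x ⁻¹) ∙ (z ∙ z ⁻¹)     ≈⟨ ∙-congˡ (x≈y⇒x∙y⁻¹≈ε refl) ⟩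
      (y ∙ x ⁻¹) ∙ ε            ≈⟨ identityʳ _ ⟩
      y ∙ x ⁻¹                  ∎

  ∙-mono-≼ : ∀ {x y u v} → x ≼ y → u ≼ v → x ∙ u ≼ y ∙ v
  ∙-mono-≼ {x} {y} {u} {v} x≼y u≼v = Pos-resp (⁻¹-∙-interchange x y u v) (Pos-∙ x≼y u≼v)

  ∙-cancelʳ-≼ : ∀ {x y} z → x ∙ z ≼ y ∙ z → x ≼ y
  ∙-cancelʳ-≼ {x} {y} z = Pos-resp (∙-cancelʳ-⁻¹ x y z)

  ≼-reflexive : ∀ {x y} → x ≈ y → x ≼ y
  ≼-reflexive x≈y = Pos-resp (sym (x≈y⇒x∙y⁻¹≈ε (sym x≈y))) Pos-ε

  ≼-refl : ∀ {x} → x ≼ x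
  ≼-refl = ≼-reflexive refl

  ≼-trans : ∀ {x y z} → x ≼ y → y ≼ z → x ≼ z
  ≼-trans {x} {y} {z} x≼y y≼z =
    ∙-cancelʳ-≼ y (Pos-resp (∙-congʳ (comm y z)) (∙-mono-≼ x≼y y≼z))

  ≼-isPreorder : IsPreorder _≈_ _≼_
  ≼-isPreorder = record
    { isEquivalence = isEquivalence ; reflexive = ≼-reflexive ; trans = ≼-trans }

  ≼-preorder : Preorder a ℓ p
  ≼-preorder = record { isPreorder = ≼-isPreorder }

  module ≼-Reasoning = Relation.Binary.Reasoning.Preorder ≼-preorder

  sum-mono-≼ : ∀ {n} {v w : Vector Carrier n} → (∀ i → v i ≼ w i) → sum v ≼ sum w
  sum-mono-≼ {zero}  v≼w = ≼-refl
  sum-mono-≼ {suc n} v≼w = ∙-mono-≼ (v≼w Fin.zero) (sum-mono-≼ (v≼w ∘ Fin.suc))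

module ShiftAction {a ℓ} (M : CommutativeMonoid a ℓ) where

  open CommutativeMonoid M
  open import Data.Nat using (_+_)
  open ℕPoly using (addP; scaleP; mulP; coeff)
  open import Algebra.Definitions.RawMonoid rawMonoid using (_×_)
  open import Algebra.Properties.Monoid.Mult monoid using (×-congʳ; ×-homo-1; ×-homo-+; ×-assocˡ)
  open import Algebra.Properties.CommutativeMonoid.Mult M using (×-distrib-+)
  open import Algebra.Properties.CommutativeSemigroup commutativeSemigroup using (interchange)
  open import Algebra.Properties.Monoid.Sum monoid using (sum; sum-syntax; sum-cong-≗; sum-replicate; sum-replicate-zero; sum-init-last)
  open import Relation.Binary.Reasoning.Setoid setoid

  -- (Q ⟨E⟩ a) t is the t-th term of Q(E) a, where E is the shift (E a) t = a (suc t).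
  infix 8 _⟨E⟩_
  _⟨E⟩_ : List ℕ → (ℕ → Carrier) → ℕ → Carrier
  ([]      ⟨E⟩ a) t = ε
  ((x ∷ Q) ⟨E⟩ a) t = x × a t ∙ (Q ⟨E⟩ a) (suc t)

  ⟨E⟩-cong : ∀ Q {a b} → (∀ t → a t ≈ b t) → ∀ t → (Q ⟨E⟩ a) t ≈ (Q ⟨E⟩ b) t
  ⟨E⟩-cong []      a≈b t = refl
  ⟨E⟩-cong (x ∷ Q) a≈b t = ∙-cong (×-congʳ x (a≈b t)) (⟨E⟩-cong Q a≈b (suc t))

  addP-⟨E⟩ : ∀ P Q a t → (addP P Q ⟨E⟩ a) t ≈ (P ⟨E⟩ a) t ∙ (Q ⟨E⟩ a) t
  addP-⟨E⟩ []      Q       a t = sym (identityˡ _)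
  addP-⟨E⟩ (x ∷ P) []      a t = sym (identityʳ _)
  addP-⟨E⟩ (x ∷ P) (y ∷ Q) a t = begin
    (x + y) × a t ∙ (addP P Q ⟨E⟩ a) (suc t)
      ≈⟨ ∙-cong (×-homo-+ (a t) x y) (addP-⟨E⟩ P Q a (suc t)) ⟩
    (x × a t ∙ y × a t) ∙ ((P ⟨E⟩ a) (suc t) ∙ (Q ⟨E⟩ a) (suc t))
      ≈⟨ interchange _ _ _ _ ⟩
    (x × a t ∙ (P ⟨E⟩ a) (suc t)) ∙ (y × a t ∙ (Q ⟨E⟩ a) (suc t)) ∎

  scaleP-⟨E⟩ : ∀ x Q a t → (scaleP x Q ⟨E⟩ a) t ≈ x × (Q ⟨E⟩ a) t
  scaleP-⟨E⟩ x []      a t = trans (sym (sum-replicate-zero x)) (sum-replicate x)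
  scaleP-⟨E⟩ x (y ∷ Q) a t = begin
    (x ℕ.* y) × a t ∙ (scaleP x Q ⟨E⟩ a) (suc t)
      ≈⟨ ∙-cong (sym (×-assocˡ (a t) x y)) (scaleP-⟨E⟩ x Q a (suc t)) ⟩
    x × (y × a t) ∙ x × (Q ⟨E⟩ a) (suc t) ≈⟨ sym (×-distrib-+ _ _ x) ⟩
    x × (y × a t ∙ (Q ⟨E⟩ a) (suc t)) ∎

  mulP-⟨E⟩ : ∀ P Q a t → (mulP P Q ⟨E⟩ a) t ≈ (P ⟨E⟩ (Q ⟨E⟩ a)) t
  mulP-⟨E⟩ []      Q a t = refl
  mulP-⟨E⟩ (x ∷ P) Q a t = begin
    (addP (scaleP x Q) (0 ∷ mulP P Q) ⟨E⟩ a) t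
      ≈⟨ addP-⟨E⟩ (scaleP x Q) (0 ∷ mulP P Q) a t ⟩
    (scaleP x Q ⟨E⟩ a) t ∙ (ε ∙ (mulP P Q ⟨E⟩ a) (suc t))
      ≈⟨ ∙-cong (scaleP-⟨E⟩ x Q a t) (identityˡ _) ⟩
    x × (Q ⟨E⟩ a) t ∙ (mulP P Q ⟨E⟩ a) (suc t)
      ≈⟨ ∙-congˡ (mulP-⟨E⟩ P Q a (suc t)) ⟩
    x × (Q ⟨E⟩ a) t ∙ (P ⟨E⟩ (Q ⟨E⟩ a)) (suc t) ∎

  ⟨E⟩-as-sum : ∀ Q a t → (Q ⟨E⟩ a) t ≈ ∑[ k < length Q ] (coeff Q (toℕ k) × a (toℕ k + t))
  ⟨E⟩-as-sum []      a t = refl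
  ⟨E⟩-as-sum (x ∷ Q) a t = ∙-congˡ (begin
    (Q ⟨E⟩ a) (suc t)                                           ≈⟨ ⟨E⟩-as-sum Q a (suc t) ⟩
    ∑[ k < length Q ] (coeff Q (toℕ k) × a (toℕ k + suc t))      ≡⟨ sum-cong-≗ {length Q} (λ k → ≡.cong (λ u → coeff Q (toℕ k) × a u) (ℕ.+-suc (toℕ k) t)) ⟩
    ∑[ k < length Q ] (coeff Q (toℕ k) × a (suc (toℕ k + t)))    ∎)

  window : ℕ → (ℕ → Carrier) → ℕ → Carrier
  window c a x = ∑[ t < c ] a (toℕ t + x)

  window-suc : ∀ c a x → window c a (suc x) ≡ ∑[ t < c ] a (suc (toℕ t + x))
  window-suc c a x = sum-cong-≗ {c} (λ t → ≡.cong a (ℕ.+-suc (toℕ t) x))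

  window-shift : ∀ c a x → window c a (suc x) ∙ a x ≈ window c a x ∙ a (c + x)
  window-shift c a x = begin
    window c a (suc x) ∙ a x                 ≡⟨ ≡.cong (_∙ a x) (window-suc c a x) ⟩
    ∑[ t < c ] a (suc (toℕ t + x)) ∙ a x     ≈⟨ comm _ _ ⟩
    window (suc c) a x                       ≈⟨ sum-init-last (λ t → a (toℕ t + x)) ⟩
    sum {c} (init (λ t → a (toℕ t + x))) ∙ a (toℕ (Fin.fromℕ c) + x)
      ≡⟨ ≡.cong₂ _∙_ (sum-cong-≗ {c} (λ t → ≡.cong (λ u → a (u + x)) (toℕ-inject₁ t)))
                     (≡.cong (λ u → a (u + x)) (toℕ-fromℕ c)) ⟩
    window c a x ∙ a (c + x)                 ∎

  replicate-⟨E⟩ : ∀ c a t → (replicate c 1 ⟨E⟩ a) t ≈ window c a t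
  replicate-⟨E⟩ zero    a t = refl
  replicate-⟨E⟩ (suc c) a t = ∙-cong (×-homo-1 (a t)) (begin
    (replicate c 1 ⟨E⟩ a) (suc t)  ≈⟨ replicate-⟨E⟩ c a (suc t) ⟩
    window c a (suc t)             ≡⟨ window-suc c a t ⟩
    ∑[ k < c ] a (suc (toℕ k + t)) ∎)

  powℕ-⟨E⟩ : ∀ s n a t → (powℕ (replicate (suc s) 1) n ⟨E⟩ a) t ≈ fold a (window (suc s)) n t
  powℕ-⟨E⟩ s zero    a t = trans (identityʳ _) (×-homo-1 (a t))
  powℕ-⟨E⟩ s (suc n) a t = begin
    (mulP ones (powℕ ones n) ⟨E⟩ a) t           ≈⟨ mulP-⟨E⟩ ones (powℕ ones n) a t ⟩
    (ones ⟨E⟩ (powℕ ones n ⟨E⟩ a)) t            ≈⟨ ⟨E⟩-cong ones (λ u → powℕ-⟨E⟩ s n a u) t ⟩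
    (ones ⟨E⟩ fold a (window (suc s)) n) t      ≈⟨ replicate-⟨E⟩ (suc s) _ t ⟩
    fold a (window (suc s)) (suc n) t           ∎
    where
    ones : List ℕ
    ones = replicate (suc s) 1

module Convolution {c ℓ} (R : CommutativeRing c ℓ) where

  open CommutativeRing R
  open import Algebra.Construct.Pointwise ℕ using (abelianGroup)

  Seq : Set c
  Seq = ℕ → Carrier

  seqGroup : AbelianGroup c ℓ
  seqGroup = abelianGroup +-abelianGroup

  open AbelianGroup seqGroup public using () renaming
    ( _≈_ to _≋_; _∙_ to infixl 6 _⊕_; ε to 0ₛ; setoid to ≋-setoid; commutativeMonoid to seqMonoid
    ; ∙-cong to ⊕-cong; ∙-congˡ to ⊕-congˡ; ∙-congʳ to ⊕-congʳ; assoc to ⊕-assoc )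
  open import Algebra.Properties.Monoid.Sum (CommutativeMonoid.monoid seqMonoid) using (sum; sum-syntax)

  infixl 7 _⊛_
  _⊛_ : Seq → Seq → Seq
  (a ⊛ b) zero    = a 0 * b 0
  (a ⊛ b) (suc i) = a 0 * b (suc i) + ((a ∘ suc) ⊛ b) i

  ⊛-cong : ∀ {a a' b b'} → a ≋ a' → b ≋ b' → a ⊛ b ≋ a' ⊛ b'
  ⊛-cong a≋a' b≋b' zero    = *-cong (a≋a' 0) (b≋b' 0)
  ⊛-cong a≋a' b≋b' (suc i) = +-cong (*-cong (a≋a' 0) (b≋b' (suc i))) (⊛-cong (a≋a' ∘ suc) b≋b' i)

  ⊛-zeroˡ : ∀ b → 0ₛ ⊛ b ≋ 0ₛ
  ⊛-zeroˡ b zero    = zeroˡ (b 0)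
  ⊛-zeroˡ b (suc i) = trans (+-cong (zeroˡ _) (⊛-zeroˡ b i)) (+-identityˡ 0#)

  ⊛-distribʳ : ∀ a a' b → (a ⊕ a') ⊛ b ≋ a ⊛ b ⊕ a' ⊛ b
  ⊛-distribʳ a a' b zero    = distribʳ _ _ _
  ⊛-distribʳ a a' b (suc i) =
    trans (+-cong (distribʳ _ _ _) (⊛-distribʳ (a ∘ suc) (a' ∘ suc) b i)) (interchange _ _ _ _)
    where open import Algebra.Properties.CommutativeSemigroup +-commutativeSemigroup using (interchange)

  ⊛-unfoldʳ : ∀ a b i → (a ⊛ b) (suc i) ≈ (a ⊛ (b ∘ suc)) i + a (suc i) * b 0
  ⊛-unfoldʳ a b zero    = refl
  ⊛-unfoldʳ a b (suc i) =
    trans (+-congˡ (⊛-unfoldʳ (a ∘ suc) b i)) (sym (+-assoc _ _ _))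

  ⊛-comm : ∀ a b → a ⊛ b ≋ b ⊛ a
  ⊛-comm a b zero    = *-comm (a 0) (b 0)
  ⊛-comm a b (suc i) = begin
    a 0 * b (suc i) + ((a ∘ suc) ⊛ b) i    ≈⟨ +-cong (*-comm _ _) (⊛-comm (a ∘ suc) b i) ⟩
    b (suc i) * a 0 + (b ⊛ (a ∘ suc)) i    ≈⟨ +-comm _ _ ⟩
    (b ⊛ (a ∘ suc)) i + b (suc i) * a 0    ≈⟨ ⊛-unfoldʳ b a i ⟨
    (b ⊛ a) (suc i)                        ∎
    where open import Relation.Binary.Reasoning.Setoid setoid

  ⊛-distribˡ : ∀ a b b' → a ⊛ (b ⊕ b') ≋ a ⊛ b ⊕ a ⊛ b'
  ⊛-distribˡ a b b' = begin
    a ⊛ (b ⊕ b')      ≈⟨ ⊛-comm a (b ⊕ b') ⟩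
    (b ⊕ b') ⊛ a      ≈⟨ ⊛-distribʳ b b' a ⟩
    b ⊛ a ⊕ b' ⊛ a    ≈⟨ ⊕-cong (⊛-comm b a) (⊛-comm b' a) ⟩
    a ⊛ b ⊕ a ⊛ b'    ∎
    where open import Relation.Binary.Reasoning.Setoid ≋-setoid

  ⊛-sumˡ : ∀ {n} (v : Vector Seq n) b → sum v ⊛ b ≋ ∑[ t < n ] (v t ⊛ b)
  ⊛-sumˡ {zero}  v b = ⊛-zeroˡ b
  ⊛-sumˡ {suc n} v b i =
    trans (⊛-distribʳ (v Fin.zero) (sum (v ∘ Fin.suc)) b i) (+-congˡ (⊛-sumˡ (v ∘ Fin.suc) b i))

  ⊛-sumʳ : ∀ {n} a (v : Vector Seq n) → a ⊛ sum v ≋ ∑[ t < n ] (a ⊛ v t)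
  ⊛-sumʳ {zero}  a v i = trans (⊛-comm a 0ₛ i) (⊛-zeroˡ a i)
  ⊛-sumʳ {suc n} a v i =
    trans (⊛-distribˡ a (v Fin.zero) (sum (v ∘ Fin.suc)) i) (+-congˡ (⊛-sumʳ a (v ∘ Fin.suc) i))

  open PolyOps 0# _+_ _*_

  coeff-addP : ∀ P Q → coeff (addP P Q) ≋ coeff P ⊕ coeff Q
  coeff-addP []      Q       i       = sym (+-identityˡ _)
  coeff-addP (x ∷ P) []      i       = sym (+-identityʳ _)
  coeff-addP (x ∷ P) (y ∷ Q) zero    = refl
  coeff-addP (x ∷ P) (y ∷ Q) (suc i) = coeff-addP P Q i

  coeff-scaleP : ∀ x Q i → coeff (scaleP x Q) i ≈ x * coeff Q i
  coeff-scaleP x []      i       = sym (zeroʳ x)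
  coeff-scaleP x (y ∷ Q) zero    = refl
  coeff-scaleP x (y ∷ Q) (suc i) = coeff-scaleP x Q i

  coeff-mulP : ∀ P Q → coeff (mulP P Q) ≋ coeff P ⊛ coeff Q
  coeff-mulP []      Q i       = sym (⊛-zeroˡ (coeff Q) i)
  coeff-mulP (x ∷ P) Q zero    = trans (coeff-addP (scaleP x Q) (0# ∷ mulP P Q) 0)
                                       (trans (+-identityʳ _) (coeff-scaleP x Q 0))
  coeff-mulP (x ∷ P) Q (suc i) = trans (coeff-addP (scaleP x Q) (0# ∷ mulP P Q) (suc i))
                                       (+-cong (coeff-scaleP x Q (suc i)) (coeff-mulP P Q i))

  coeff-sumP-applyUpTo : ∀ N (G : ℕ → Poly) → coeff (sumP (applyUpTo G N)) ≋ ∑[ k < N ] coeff (G (toℕ k))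
  coeff-sumP-applyUpTo zero    G i = refl
  coeff-sumP-applyUpTo (suc N) G i =
    trans (coeff-addP (G 0) (sumP (applyUpTo (G ∘ suc) N)) i) (+-congˡ (coeff-sumP-applyUpTo N (G ∘ suc) i))

module StrongQLogConcavity {c ℓ p} (R : OrderedCommutativeRing c ℓ p) where

  open OrderedCommutativeRing R hiding (_+_; _*_)
  open OverRing R
  open Convolution commRing public
  open import Algebra.Properties.Ring ring using (-0#≈0#)
  open import Data.Nat using (_+_; _*_; _∸_)

  NonNeg-0# : NonNeg 0#
  NonNeg-0# with NonNeg-total 0#
  ... | inj₁ 0#≥0  = 0#≥0
  ... | inj₂ -0#≥0 = NonNeg-resp -0#≈0# -0#≥0

  -- With this cone, P ≥q Q unfolds to coeff Q ≼ coeff P.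
  open PositiveCone seqGroup (λ a → ∀ i → NonNeg (a i))
    (λ a≋b a≥0 i → NonNeg-resp (a≋b i) (a≥0 i)) (λ _ → NonNeg-0#)
    (λ a≥0 b≥0 i → NonNeg-+ (a≥0 i) (b≥0 i))
    public renaming (∙-mono-≼ to ⊕-mono-≼; ∙-cancelʳ-≼ to ⊕-cancelʳ-≼)
  open ShiftAction seqMonoid public
  open import Algebra.Definitions.RawMonoid (CommutativeMonoid.rawMonoid seqMonoid) using (_×_)
  open import Algebra.Properties.Monoid.Sum (CommutativeMonoid.monoid seqMonoid)
    using (sum-syntax; sum-cong-≋; sum-cong-≗)
  open import Algebra.Properties.CommutativeSemigroup (CommutativeMonoid.commutativeSemigroup seqMonoid)
    using (x∙yz≈xz∙y)

  LogConcave : (ℕ → Seq) → Set p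
  LogConcave a = ∀ {k l} → k ≤ l → a k ⊛ a (suc l) ≼ a (suc k) ⊛ a l

  CrossLogConcave : (ℕ → Seq) → (ℕ → Seq) → Set p
  CrossLogConcave a b = ∀ d {k l} → k ≤ l → a k ⊛ b (d + l) ≼ a (d + k) ⊛ b l

  logConcave⇒crossLogConcave : ∀ {a} → LogConcave a → CrossLogConcave a a
  logConcave⇒crossLogConcave     lc zero    k≤l = ≼-refl
  logConcave⇒crossLogConcave {a} lc (suc d) {k} {l} k≤l with ℕ.m≤n⇒m<n∨m≡n k≤l
  ... | inj₁ k<l = begin
    a k ⊛ a (suc d + l)       ≲⟨ lc (ℕ.≤-trans k≤l (ℕ.m≤n+m l d)) ⟩
    a (suc k) ⊛ a (d + l)     ≲⟨ logConcave⇒crossLogConcave lc d k<l ⟩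
    a (d + suc k) ⊛ a l       ≡⟨ ≡.cong (λ j → a j ⊛ a l) (ℕ.+-suc d k) ⟩
    a (suc d + k) ⊛ a l       ∎
    where open ≼-Reasoning
  ... | inj₂ ≡.refl = ≼-reflexive (⊛-comm (a k) (a (suc d + k)))

  ⊛-windowˡ : ∀ c a x b → window c a x ⊛ b ≋ ∑[ t < c ] (a (toℕ t + x) ⊛ b)
  ⊛-windowˡ c a x b = ⊛-sumˡ {c} (λ t → a (toℕ t + x)) b

  ⊛-windowʳ : ∀ c a x b → b ⊛ window c a x ≋ ∑[ t < c ] (b ⊛ a (toℕ t + x))
  ⊛-windowʳ c a x b = ⊛-sumʳ {c} b (λ t → a (toℕ t + x))

  ⊛-window-sucˡ : ∀ c a k b → window c a (suc k) ⊛ b ⊕ a k ⊛ b ≋ window c a k ⊛ b ⊕ a (c + k) ⊛ b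
  ⊛-window-sucˡ c a k b = begin
    window c a (suc k) ⊛ b ⊕ a k ⊛ b  ≈⟨ ⊛-distribʳ _ _ b ⟨
    (window c a (suc k) ⊕ a k) ⊛ b    ≈⟨ ⊛-cong (window-shift c a k) (λ _ → refl) ⟩
    (window c a k ⊕ a (c + k)) ⊛ b    ≈⟨ ⊛-distribʳ _ _ b ⟩
    window c a k ⊛ b ⊕ a (c + k) ⊛ b  ∎
    where open import Relation.Binary.Reasoning.Setoid ≋-setoid

  ⊛-window-sucʳ : ∀ c a l b → b ⊛ window c a (suc l) ⊕ b ⊛ a l ≋ b ⊛ window c a l ⊕ b ⊛ a (c + l)
  ⊛-window-sucʳ c a l b = begin
    b ⊛ window c a (suc l) ⊕ b ⊛ a l  ≈⟨ ⊛-distribˡ b _ _ ⟨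
    b ⊛ (window c a (suc l) ⊕ a l)    ≈⟨ ⊛-cong (λ _ → refl) (window-shift c a l) ⟩
    b ⊛ (window c a l ⊕ a (c + l))    ≈⟨ ⊛-distribˡ b _ _ ⟩
    b ⊛ window c a l ⊕ b ⊛ a (c + l)  ∎
    where open import Relation.Binary.Reasoning.Setoid ≋-setoid

  -- Adding Z to both sides turns the window shift W (k + 1) = W k + a (c + k) - a k into a
  -- cancellation-free identity; what remains are two sums of cross inequalities.
  window-logConcave : ∀ c {a} → CrossLogConcave a a → LogConcave (window c a)
  window-logConcave c {a} cross {k} {l} k≤l = ⊕-cancelʳ-≼ Z (begin
    W k ⊛ W (suc l) ⊕ (a k ⊛ W l ⊕ W k ⊛ a l)  ≈⟨ x∙yz≈xz∙y _ _ _ ⟩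
    (W k ⊛ W (suc l) ⊕ W k ⊛ a l) ⊕ a k ⊛ W l  ≈⟨ ⊕-congʳ (⊛-window-sucʳ c a l (W k)) ⟩
    (W k ⊛ W l ⊕ W k ⊛ a (c + l)) ⊕ a k ⊛ W l  ≈⟨ ⊕-assoc _ _ _ ⟩
    W k ⊛ W l ⊕ (W k ⊛ a (c + l) ⊕ a k ⊛ W l)  ≲⟨ ⊕-mono-≼ ≼-refl (⊕-mono-≼ far near) ⟩
    W k ⊛ W l ⊕ (a (c + k) ⊛ W l ⊕ W k ⊛ a l)  ≈⟨ ⊕-assoc _ _ _ ⟨
    (W k ⊛ W l ⊕ a (c + k) ⊛ W l) ⊕ W k ⊛ a l  ≈⟨ ⊕-congʳ (⊛-window-sucˡ c a k (W l)) ⟨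
    (W (suc k) ⊛ W l ⊕ a k ⊛ W l) ⊕ W k ⊛ a l  ≈⟨ ⊕-assoc _ _ _ ⟩
    W (suc k) ⊛ W l ⊕ (a k ⊛ W l ⊕ W k ⊛ a l)  ∎)
    where
    open ≼-Reasoning

    W : ℕ → Seq
    W = window c a

    Z : Seq
    Z = a k ⊛ W l ⊕ W k ⊛ a l

    shift : ∀ t x → t ≤ c → c ∸ t + (t + x) ≡ c + x
    shift t x t≤c = ≡.trans (≡.sym (ℕ.+-assoc (c ∸ t) t x)) (≡.cong (_+ x) (ℕ.m∸n+n≡m t≤c))

    far-term : ∀ t → t ≤ c → a (t + k) ⊛ a (c + l) ≼ a (c + k) ⊛ a (t + l)
    far-term t t≤c = begin
      a (t + k) ⊛ a (c + l)                ≡⟨ ≡.cong (λ j → a (t + k) ⊛ a j) (shift t l t≤c) ⟨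
      a (t + k) ⊛ a (c ∸ t + (t + l))      ≲⟨ cross (c ∸ t) (ℕ.+-monoʳ-≤ t k≤l) ⟩
      a (c ∸ t + (t + k)) ⊛ a (t + l)      ≡⟨ ≡.cong (λ j → a j ⊛ a (t + l)) (shift t k t≤c) ⟩
      a (c + k) ⊛ a (t + l)                ∎

    far : W k ⊛ a (c + l) ≼ a (c + k) ⊛ W l
    far = begin
      W k ⊛ a (c + l)                            ≈⟨ ⊛-windowˡ c a k (a (c + l)) ⟩
      ∑[ t < c ] (a (toℕ t + k) ⊛ a (c + l))     ≲⟨ sum-mono-≼ {c} (λ t → far-term (toℕ t) (ℕ.<⇒≤ (toℕ<n t))) ⟩
      ∑[ t < c ] (a (c + k) ⊛ a (toℕ t + l))     ≈⟨ ⊛-windowʳ c a l (a (c + k)) ⟨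
      a (c + k) ⊛ W l                            ∎

    near : a k ⊛ W l ≼ W k ⊛ a l
    near = begin
      a k ⊛ W l                                  ≈⟨ ⊛-windowʳ c a l (a k) ⟩
      ∑[ t < c ] (a k ⊛ a (toℕ t + l))           ≲⟨ sum-mono-≼ {c} (λ t → cross (toℕ t) k≤l) ⟩
      ∑[ t < c ] (a (toℕ t + k) ⊛ a l)           ≈⟨ ⊛-windowˡ c a k (a l) ⟨
      W k ⊛ a l                                  ∎

  window-crossLogConcave : ∀ c {a b} → CrossLogConcave a b → CrossLogConcave a (window c b)
  window-crossLogConcave c {a} {b} cross d {k} {l} k≤l = begin
    a k ⊛ window c b (d + l)                ≈⟨ ⊛-windowʳ c b (d + l) (a k) ⟩
    ∑[ t < c ] (a k ⊛ b (toℕ t + (d + l)))  ≡⟨ sum-cong-≗ {c} (λ t → ≡.cong (λ j → a k ⊛ b j) (+-left-comm (toℕ t) d l)) ⟩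
    ∑[ t < c ] (a k ⊛ b (d + (toℕ t + l)))  ≲⟨ sum-mono-≼ {c} (λ t → cross d (ℕ.≤-trans k≤l (ℕ.m≤n+m l (toℕ t)))) ⟩
    ∑[ t < c ] (a (d + k) ⊛ b (toℕ t + l))  ≈⟨ ⊛-windowʳ c b l (a (d + k)) ⟨
    a (d + k) ⊛ window c b l                ∎
    where
    open ≼-Reasoning
    open import Algebra.Properties.CommutativeSemigroup ℕ.+-commutativeSemigroup
      using () renaming (x∙yz≈y∙xz to +-left-comm)

  windows-crossLogConcave : ∀ c {a} → LogConcave a → ∀ {n m} → n ≤ m →
                            CrossLogConcave (fold a (window c) n) (fold a (window c) m)
  windows-crossLogConcave c {a} lc {n} {m} n≤m =
    ≡.subst (CrossLogConcave (A n)) (≡.trans (≡.sym (fold-+ a (window c) (m ∸ n))) (≡.cong A (ℕ.m∸n+n≡m n≤m)))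
      (iterate (m ∸ n) (self n))
    where
    A : ℕ → ℕ → Seq
    A = fold a (window c)

    self : ∀ n → CrossLogConcave (A n) (A n)
    self zero    = logConcave⇒crossLogConcave lc
    self (suc n) = logConcave⇒crossLogConcave (window-logConcave c (self n))

    iterate : ∀ {b} d → CrossLogConcave (A n) b → CrossLogConcave (A n) (fold b (window c) d)
    iterate zero    cross = cross
    iterate (suc d) cross = window-crossLogConcave c (iterate d cross)

  crossLogConcave⇒window₀ : ∀ c {a b} → CrossLogConcave a b → a 0 ⊛ window c b 0 ≼ window c a 0 ⊛ b 0
  crossLogConcave⇒window₀ c {a} {b} cross = begin
    a 0 ⊛ window c b 0                  ≈⟨ ⊛-windowʳ c b 0 (a 0) ⟩
    ∑[ t < c ] (a 0 ⊛ b (toℕ t + 0))    ≲⟨ sum-mono-≼ {c} (λ t → cross (toℕ t) z≤n) ⟩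
    ∑[ t < c ] (a (toℕ t + 0) ⊛ b 0)    ≈⟨ ⊛-windowˡ c a 0 (b 0) ⟨
    window c a 0 ⊛ b 0                  ∎
    where open ≼-Reasoning

  stronglyQLogConcave⇒logConcave : ∀ {f} → StronglyQLogConcave f → LogConcave (coeff ∘ f)
  stronglyQLogConcave⇒logConcave {f} slc {k} {l} k≤l with ℕ.m≤n⇒m<n∨m≡n k≤l
  ... | inj₁ k<l = begin
    coeff (f k) ⊛ coeff (f (suc l))       ≈⟨ coeff-mulP (f k) (f (suc l)) ⟨
    coeff (mulP (f k) (f (suc l)))        ≲⟨ slc l (suc k) (s≤s z≤n) k<l ⟩
    coeff (mulP (f (suc k)) (f l))        ≈⟨ coeff-mulP (f (suc k)) (f l) ⟩
    coeff (f (suc k)) ⊛ coeff (f l)       ∎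
    where open ≼-Reasoning
  ... | inj₂ ≡.refl = ≼-reflexive (⊛-comm (coeff (f k)) (coeff (f (suc k))))

  coeff-scaleP-fromℕ : ∀ m P → coeff (scaleP (fromℕ m) P) ≋ m × coeff P
  coeff-scaleP-fromℕ zero    P i = trans (coeff-scaleP 0# P i) (zeroˡ _)
  coeff-scaleP-fromℕ (suc m) P i = trans (coeff-scaleP _ P i) (trans (distribʳ _ _ _)
    (+-cong (*-identityˡ _) (trans (sym (coeff-scaleP _ P i)) (coeff-scaleP-fromℕ m P i))))

  coeff-B : ∀ s f n → coeff (B s f n) ≋ fold (coeff ∘ f) (window (suc s)) n 0
  coeff-B s f n = begin
    coeff (sumP (map G (upTo (suc (s * n)))))
      ≡⟨ ≡.cong (coeff ∘ sumP) (map-upTo G (suc (s * n))) ⟩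
    coeff (sumP (applyUpTo G (suc (s * n))))
      ≈⟨ coeff-sumP-applyUpTo (suc (s * n)) G ⟩
    ∑[ k < suc (s * n) ] coeff (G (toℕ k))
      ≈⟨ sum-cong-≋ {suc (s * n)} (λ k → coeff-scaleP-fromℕ (binom s n (toℕ k)) (f (toℕ k))) ⟩
    ∑[ k < suc (s * n) ] (binom s n (toℕ k) × coeff (f (toℕ k)))
      ≡⟨ ≡.cong (λ N → ∑[ k < N ] (ℕPoly.coeff Q (toℕ k) × coeff (f (toℕ k)))) (length-powℕ s n) ⟨
    ∑[ k < length Q ] (ℕPoly.coeff Q (toℕ k) × coeff (f (toℕ k)))
      ≡⟨ sum-cong-≗ {length Q} (λ k → ≡.cong (λ j → ℕPoly.coeff Q (toℕ k) × coeff (f j)) (ℕ.+-identityʳ (toℕ k))) ⟨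
    ∑[ k < length Q ] (ℕPoly.coeff Q (toℕ k) × coeff (f (toℕ k + 0)))
      ≈⟨ ⟨E⟩-as-sum Q (coeff ∘ f) 0 ⟨
    (Q ⟨E⟩ (coeff ∘ f)) 0
      ≈⟨ powℕ-⟨E⟩ s n (coeff ∘ f) 0 ⟩
    fold (coeff ∘ f) (window (suc s)) n 0
      ∎
    where
    open import Relation.Binary.Reasoning.Setoid ≋-setoid

    G : ℕ → Poly
    G k = scaleP (fromℕ (binom s n k)) (f k)

    Q : List ℕ
    Q = powℕ (replicate (suc s) 1) n

mainTheorem6 : ∀ {c ℓ p} (R : OrderedCommutativeRing c ℓ p) → let open OverRing R in
    (s : ℕ) → 1 ≤ s → (f : ℕ → Poly) →
    StronglyQLogConcave f → StronglyQLogConcave (B s f)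
mainTheorem6 R s _ f f-sqlc m (suc n) _ n<m = begin
  coeff (mulP (B s f n) (B s f (suc m)))    ≈⟨ coeff-mulP (B s f n) (B s f (suc m)) ⟩
  coeff (B s f n) ⊛ coeff (B s f (suc m))   ≈⟨ ⊛-cong (coeff-B s f n) (coeff-B s f (suc m)) ⟩
  A n 0 ⊛ window (suc s) (A m) 0
    ≲⟨ crossLogConcave⇒window₀ (suc s) (windows-crossLogConcave (suc s) f-logConcave (ℕ.<⇒≤ n<m)) ⟩
  window (suc s) (A n) 0 ⊛ A m 0            ≈⟨ ⊛-cong (coeff-B s f (suc n)) (coeff-B s f m) ⟨
  coeff (B s f (suc n)) ⊛ coeff (B s f m)   ≈⟨ coeff-mulP (B s f (suc n)) (B s f m) ⟨
  coeff (mulP (B s f (suc n)) (B s f m))    ∎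
  where
  open OverRing R
  open StrongQLogConcavity R
  open ≼-Reasoning

  A : ℕ → ℕ → Seq
  A = fold (coeff ∘ f) (window (suc s))

  f-logConcave : LogConcave (coeff ∘ f)
  f-logConcave = stronglyQLogConcave⇒logConcave {f} f-sqlc
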